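{- Let $d\ge1$ and $\mathbf{u}=(u_1,\dots,u_d)\in \binom{\mathbb{N}}{d}$. Then $\mathrm{Inc}(B(\mathbf{u}))=B(\mathbf{u}+\mathbf{1})$, where $\mathbf{u}+\mathbf{1}=(u_1+1,\dots,u_d+1)$.
   Context: $\mathbb{N}=\{1,2,\dots\}$; $\binom{\mathbb{N}}{d}$ is the set of $d$-subsets of $\mathbb{N}$, each written $\mathbf{u}=(u_1,\dots,u_d)$ with $u_1<\dots<u_d$. The Borel order: $\mathbf{v}\le_B\mathbf{u}$ if $v_i\le u_i$ for all $i=1,\dots,d$; $B(\mathbf{u})=\{\mathbf{v}\in\binom{\mathbb{N}}{d}\mid\mathbf{v}\le_B\mathbf{u}\}$. $\mathrm{Inc}_1$ is the set of maps $\pi:\mathbb{N}\to\mathbb{N}$ with $\pi(j)<\pi(j+1)$ and $\pi(j)\le j+1$ for all $j$, acting by $\pi(\mathbf{u})=(\pi(u_1),\dots,\pi(u_d))$; for a family $\mathcal{F}$, $\mathrm{Inc}(\mathcal{F})=\{\pi(\mathbf{u})\mid\mathbf{u}\in\mathcal{F},\pi\in\mathrm{Inc}_1\}$. -}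

module Defs where

open import Data.Nat using (ℕ; suc; _≤_; _<_)
open import Data.Vec using (Vec; []; _∷_; map; lookup)
open import Data.Fin using (Fin; suc; zero)
open import Data.Product using (Σ; _×_; ∃-syntax)
open import Relation.Binary.PropositionalEquality using (_≡_)
import Data.Fin

-- ℕ of the paper = {1,2,...}; we use Agda ℕ and require positivity explicitly.

StrictInc : ∀ {d} → Vec ℕ d → Set
StrictInc {d} u = ∀ (i j : Fin d) → Data.Fin._<_ i j → lookup u i < lookup u j

IsDSubset : ∀ {d} → Vec ℕ d → Set
IsDSubset {d} u = (∀ (i : Fin d) → 1 ≤ lookup u i) × StrictInc u

_≤B_ : ∀ {d} → Vec ℕ d → Vec ℕ d → Set
_≤B_ {d} v u = ∀ (i : Fin d) → lookup v i ≤ lookup u i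

B : ∀ {d} → Vec ℕ d → Vec ℕ d → Set
B u v = IsDSubset v × (v ≤B u)

-- Inc₁: maps π : {1,2,…} → {1,2,…} with π(j) < π(j+1) and π(j) ≤ j+1 for all j ≥ 1.
-- (values of π at 0 are irrelevant)
IsInc1 : (ℕ → ℕ) → Set
IsInc1 π = (∀ j → 1 ≤ j → 1 ≤ π j)
         × (∀ j → 1 ≤ j → π j < π (suc j))
         × (∀ j → 1 ≤ j → π j ≤ suc j)

Inc : ∀ {d} → (Vec ℕ d → Set) → Vec ℕ d → Set
Inc {d} F v = Σ (ℕ → ℕ) λ π → Σ (Vec ℕ d) λ u → IsInc1 π × F u × (map π u ≡ v)

plus1 : ∀ {d} → Vec ℕ d → Vec ℕ d
plus1 = map suc

module Submission where

-- ⊆ : An Inc₁-map π is strictly increasing on positive numbers and satisfies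
--     π(j) ≤ j + 1.  Hence, for w ∈ B(u), π(w) is again a d-subset and
--     π(w_i) ≤ w_i + 1 ≤ u_i + 1.
-- ⊇ : Let v ∈ B(u + 1).  If v ≤_B u, then v = id(v) with id ∈ Inc₁.  Otherwise
--     take the first index m with v_m > u_m, so v_m = u_m + 1, and put
--     k = u_m.  Every entry of v avoids k: entries before m satisfy
--     v_i ≤ u_i < k, entries from m on satisfy v_i ≥ v_m > k (a "cut" at k).
--     The map skip_k (identity below k, j ↦ j + 1 from k on) lies in Inc₁, and
--     its partial inverse unskip_k, applied to v, gives w ∈ B(u) with
--     skip_k(w) = v.

open import Defs
open import Data.Nat using (ℕ; suc; pred; _≤_; _<_; s≤s; _≤?_; _<?_)
open import Data.Nat.Properties
open import Data.Vec using (Vec; map; lookup)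
open import Data.Vec.Properties using (lookup-map; map-∘)
open import Data.Vec.Relation.Binary.Pointwise.Extensional using (ext; Pointwise-≡⇒≡)
open import Data.Fin as F using (Fin; toℕ)
import Data.Fin.Properties as FP
open import Data.Product using (∃; _×_; _,_)
open import Data.Sum using (_⊎_; inj₁; inj₂)
open import Data.Empty using (⊥-elim)
open import Function.Bundles using (_⇔_; mk⇔)
open import Relation.Binary.PropositionalEquality
open import Relation.Binary.Definitions using (tri<; tri≈; tri>)
open import Relation.Nullary using (¬_; yes; no)

map-IsDSubset : ∀ {d} (g : ℕ → ℕ) (v : Vec ℕ d) →
  (∀ i → 1 ≤ g (lookup v i)) →
  (∀ i j → lookup v i < lookup v j → g (lookup v i) < g (lookup v j)) →
  StrictInc v → IsDSubset (map g v)
map-IsDSubset g v pos mono strict =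
  (λ i → subst (1 ≤_) (sym (lookup-map i g v)) (pos i)) ,
  (λ i j i<j → subst₂ _<_ (sym (lookup-map i g v)) (sym (lookup-map j g v))
                 (mono i j (strict i j i<j)))

map-≤B : ∀ {d} (g : ℕ → ℕ) (v w : Vec ℕ d) →
  (∀ i → g (lookup v i) ≤ lookup w i) → map g v ≤B w
map-≤B g v w le i = subst (_≤ lookup w i) (sym (lookup-map i g v)) (le i)

map-fixes : ∀ {d} (g : ℕ → ℕ) (v : Vec ℕ d) →
  (∀ i → g (lookup v i) ≡ lookup v i) → map g v ≡ v
map-fixes g v fix = Pointwise-≡⇒≡ (ext λ i → trans (lookup-map i g v) (fix i))

≤B-plus1 : ∀ {d} (u v : Vec ℕ d) → v ≤B plus1 u → ∀ i → lookup v i ≤ suc (lookup u i)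
≤B-plus1 u v v≤u+1 i = subst (lookup v i ≤_) (lookup-map i suc u) (v≤u+1 i)

-- Inc₁-maps are strictly increasing on positive arguments (the defining
-- condition only compares consecutive arguments).
inc1-strictMono : ∀ π → IsInc1 π → ∀ {a c} → 1 ≤ a → a < c → π a < π c
inc1-strictMono π π∈Inc₁@(_ , step , _) {a} {suc c} 1≤a (s≤s a≤c)
  with m≤n⇒m<n∨m≡n a≤c
... | inj₁ a<c  = <-trans (inc1-strictMono π π∈Inc₁ 1≤a a<c)
                          (step c (≤-trans 1≤a (<⇒≤ a<c)))
... | inj₂ refl = step a 1≤a

Inc-B⊆B-plus1 : ∀ {d} (u v : Vec ℕ d) → Inc (B u) v → B (plus1 u) v
Inc-B⊆B-plus1 u _ (π , w , π∈Inc₁@(pos , _ , bound) , ((w-pos , w-strict) , w≤u) , refl) =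
  map-IsDSubset π w (λ i → pos _ (w-pos i))
                  (λ i _ → inc1-strictMono π π∈Inc₁ (w-pos i)) w-strict ,
  map-≤B π w (plus1 u) (λ i → subst (π (lookup w i) ≤_) (sym (lookup-map i suc u))
                        (≤-trans (bound _ (w-pos i)) (s≤s (w≤u i))))

-- skip k is the increasing bijection from ℕ onto ℕ ∖ {k}.
skip : ℕ → ℕ → ℕ
skip k j with j <? k
... | yes _ = j
... | no  _ = suc j

skip-below : ∀ {k j} → j < k → skip k j ≡ j
skip-below {k} {j} j<k with j <? k
... | yes _   = refl
... | no  j≮k = ⊥-elim (j≮k j<k)

skip-above : ∀ {k j} → k ≤ j → skip k j ≡ suc j
skip-above {k} {j} k≤j with j <? k
... | yes j<k = ⊥-elim (<⇒≱ j<k k≤j)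
... | no  _   = refl

skip-IsInc1 : ∀ k → IsInc1 (skip k)
skip-IsInc1 k = (λ j 1≤j → ≤-trans 1≤j (extensive j)) , (λ j _ → increasing j) , (λ j _ → bounded j)
  where
  extensive : ∀ j → j ≤ skip k j
  extensive j with j <? k
  ... | yes _ = ≤-refl
  ... | no  _ = n≤1+n j

  bounded : ∀ j → skip k j ≤ suc j
  bounded j with j <? k
  ... | yes _ = n≤1+n j
  ... | no  _ = ≤-refl

  increasing : ∀ j → skip k j < skip k (suc j)
  increasing j with j <? k | suc j <? k
  ... | yes _   | yes _    = ≤-refl
  ... | yes _   | no  _    = <-trans (n<1+n j) (n<1+n (suc j))
  ... | no  j≮k | yes 1+j<k = ⊥-elim (j≮k (<-trans (n<1+n j) 1+j<k))
  ... | no  _   | no  _    = ≤-refl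

-- A number avoids k if it is different from k, in a constructive form.
Avoids : ℕ → ℕ → Set
Avoids k x = x < k ⊎ k < x

unskip : ℕ → ℕ → ℕ
unskip k x with x ≤? k
... | yes _ = x
... | no  _ = pred x

unskip-below : ∀ {k x} → x < k → unskip k x ≡ x
unskip-below {k} {x} x<k with x ≤? k
... | yes _   = refl
... | no  x≰k = ⊥-elim (x≰k (<⇒≤ x<k))

unskip-above : ∀ {k x} → k < x → unskip k x ≡ pred x
unskip-above {k} {x} k<x with x ≤? k
... | yes x≤k = ⊥-elim (<⇒≱ k<x x≤k)
... | no  _   = refl

skip-unskip : ∀ {k x} → Avoids k x → skip k (unskip k x) ≡ x
skip-unskip (inj₁ x<k) rewrite unskip-below x<k = skip-below x<k
skip-unskip {x = suc x} (inj₂ (s≤s k≤x)) rewrite unskip-above (s≤s k≤x) = skip-above k≤x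

unskip-strictMono : ∀ {k x y} → Avoids k x → Avoids k y → x < y → unskip k x < unskip k y
unskip-strictMono (inj₁ x<k) (inj₁ y<k) x<y
  rewrite unskip-below x<k | unskip-below y<k = x<y
unskip-strictMono {y = suc y} (inj₁ x<k) (inj₂ (s≤s k≤y)) _
  rewrite unskip-below x<k | unskip-above (s≤s k≤y) = <-≤-trans x<k k≤y
unskip-strictMono (inj₂ k<x) (inj₁ y<k) x<y = ⊥-elim (<-asym x<y (<-trans y<k k<x))
unskip-strictMono {x = suc x} {y = suc y} (inj₂ k<x) (inj₂ k<y) (s≤s x<y)
  rewrite unskip-above k<x | unskip-above k<y = x<y

unskip-positive : ∀ {k x} → 1 ≤ k → 1 ≤ x → Avoids k x → 1 ≤ unskip k x
unskip-positive _ 1≤x (inj₁ x<k) rewrite unskip-below x<k = 1≤x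
unskip-positive {x = suc x} 1≤k _ (inj₂ (s≤s k≤x)) rewrite unskip-above (s≤s k≤x) = ≤-trans 1≤k k≤x

Cut : ∀ {d} → Vec ℕ d → Vec ℕ d → ℕ → Set
Cut {d} u v k = ∀ (i : Fin d) →
  (lookup v i < k × lookup v i ≤ lookup u i) ⊎ (k < lookup v i × lookup v i ≤ suc (lookup u i))

cut-avoids : ∀ {d} (u v : Vec ℕ d) {k} → Cut u v k → ∀ i → Avoids k (lookup v i)
cut-avoids _ _ cut i with cut i
... | inj₁ (below , _) = inj₁ below
... | inj₂ (above , _) = inj₂ above

cut⇒Inc-B : ∀ {d} (u v : Vec ℕ d) {k} → 1 ≤ k → IsDSubset v → Cut u v k → Inc (B u) v
cut⇒Inc-B u v {k} 1≤k (v-pos , v-strict) cut =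
  skip k , map (unskip k) v , skip-IsInc1 k , (w-DSubset , w≤u) , skip-w≡v
  where
  avoids : ∀ i → Avoids k (lookup v i)
  avoids = cut-avoids u v cut

  w-DSubset : IsDSubset (map (unskip k) v)
  w-DSubset = map-IsDSubset (unskip k) v (λ i → unskip-positive 1≤k (v-pos i) (avoids i))
                (λ i j → unskip-strictMono (avoids i) (avoids j)) v-strict

  entry≤u : ∀ i → unskip k (lookup v i) ≤ lookup u i
  entry≤u i with cut i
  ... | inj₁ (below , v≤u)   = subst (_≤ _) (sym (unskip-below below)) v≤u
  ... | inj₂ (above , v≤u+1) = subst (_≤ _) (sym (unskip-above above)) (pred-mono-≤ v≤u+1)

  w≤u : map (unskip k) v ≤B u
  w≤u = map-≤B (unskip k) v u entry≤u

  skip-w≡v : map (skip k) (map (unskip k) v) ≡ v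
  skip-w≡v = trans (sym (map-∘ (skip k) (unskip k) v))
                   (map-fixes (λ x → skip k (unskip k x)) v (λ i → skip-unskip (avoids i)))

below-inject : ∀ {n} {m : Fin n} (i : Fin n) → toℕ i < toℕ m → ∃ λ (j : F.Fin′ m) → F.inject j ≡ i
below-inject i i<m =
  F.fromℕ< i<m , FP.toℕ-injective (trans (FP.toℕ-inject (F.fromℕ< i<m)) (FP.toℕ-fromℕ< i<m))

first-excess-cut : ∀ {d} (u v : Vec ℕ d) → StrictInc u → StrictInc v →
  v ≤B plus1 u → ¬ (v ≤B u) → ∃ λ m → Cut u v (lookup u m)
first-excess-cut {d} u v u-strict v-strict v≤u+1 v≰u
  with FP.¬∀⟶∃¬-smallest d (λ i → lookup v i ≤ lookup u i) (λ i → lookup v i ≤? lookup u i) v≰u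
... | m , vₘ≰uₘ , before-m = m , cut
  where
  vₘ≡1+uₘ : lookup v m ≡ suc (lookup u m)
  vₘ≡1+uₘ = ≤-antisym (≤B-plus1 u v v≤u+1 m) (≰⇒> vₘ≰uₘ)

  cut : Cut u v (lookup u m)
  cut i with FP.<-cmp i m
  ... | tri< i<m _ _ with below-inject i i<m
  ...   | j , refl = inj₁ (≤-<-trans (before-m j) (u-strict i m i<m) , before-m j)
  cut i | tri≈ _ refl _ = inj₂ (≤-reflexive (sym vₘ≡1+uₘ) , ≤B-plus1 u v v≤u+1 i)
  cut i | tri> _ _ m<i =
    inj₂ (<-trans (≤-reflexive (sym vₘ≡1+uₘ)) (v-strict m i m<i) , ≤B-plus1 u v v≤u+1 i)

B-plus1⊆Inc-B : ∀ {d} (u v : Vec ℕ d) → IsDSubset u → B (plus1 u) v → Inc (B u) v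
B-plus1⊆Inc-B u v (u-pos , u-strict) (v-DSubset@(_ , v-strict) , v≤u+1)
  with FP.all? (λ i → lookup v i ≤? lookup u i)
... | yes v≤u = (λ j → j) , v , id-IsInc1 , (v-DSubset , v≤u) , map-fixes (λ j → j) v (λ _ → refl)
  where
  id-IsInc1 : IsInc1 (λ j → j)
  id-IsInc1 = (λ _ 1≤j → 1≤j) , (λ j _ → n<1+n j) , (λ j _ → n≤1+n j)
... | no v≰u with first-excess-cut u v u-strict v-strict v≤u+1 v≰u
...   | m , cut = cut⇒Inc-B u v (u-pos m) v-DSubset cut

-- The theorem.
lemma3p3 : (d : ℕ) → 1 ≤ d → (u : Vec ℕ d) → IsDSubset u →
    ∀ (v : Vec ℕ d) → Inc (B u) v ⇔ B (plus1 u) v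
lemma3p3 d _ u u-DSubset v = mk⇔ (Inc-B⊆B-plus1 u v) (B-plus1⊆Inc-B u v u-DSubset)
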